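{- Every model of $T_{P_0}$ has countable Scott rank.
   Context: $P_0$ is an $\omega$-chain and $\delta_0\equiv2$. $T_{P_0}$ is the theory in binary relations $E_n$ ($n<\omega$) asserting: each $E_n$ is an equivalence relation, $E_{n+1}$ refines $E_n$, $E_0$ has exactly $2$ classes and each $E_n$-class is split into exactly $2$ $E_{n+1}$-classes (binary refining equivalence relations). Back-and-forth relations: $(M,\bar a)\equiv_0(N,\bar b)$ iff same quantifier-free type; $(M,\bar a)\equiv_{\alpha+1}(N,\bar b)$ iff for every $a\in M$ there is $b\in N$ with $(M,\bar aa)\equiv_\alpha(N,\bar bb)$ and vice versa; limits by intersection; $\equiv_\infty$ means $\equiv_\alpha$ for all $\alpha$. $\mathrm{sr}(M)$ is the least $\alpha$ such that for all finite tuples $\bar a,\bar b$ from $M$, $(M,\bar a)\equiv_\alpha(M,\bar b)$ implies $(M,\bar a)\equiv_\infty(M,\bar b)$. "Countable" means $<\omega_1$. -}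

module Defs where

open import Level using (Level; 0ℓ) renaming (suc to lsuc)
open import Data.Nat using (ℕ; zero; suc)
open import Data.Fin using (Fin)
open import Data.Vec using (Vec; lookup; _∷ʳ_)
open import Data.Product using (Σ; ∃; _×_; _,_)
open import Data.Sum using (_⊎_)
open import Data.Empty using (⊥)
open import Relation.Nullary using (¬_)
open import Relation.Binary.PropositionalEquality using (_≡_)
open import Function.Bundles using (_⇔_)
open import Function.Definitions using (Injective)

record Str : Set₁ where
  field
    Carrier : Set
    E       : ℕ → Carrier → Carrier → Set
open Str public

record IsEquiv {A : Set} (R : A → A → Set) : Set where
  field
    refl′  : ∀ x → R x x
    sym′   : ∀ {x y} → R x y → R y x
    trans′ : ∀ {x y z} → R x y → R y z → R x z

ExactlyTwoClasses : {A : Set} → (A → A → Set) → Set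
ExactlyTwoClasses {A} R =
  Σ A λ a → Σ A λ b → ¬ R a b × (∀ c → R c a ⊎ R c b)

SplitsInTwo : {A : Set} → (R S : A → A → Set) → A → Set
SplitsInTwo {A} R S x =
  Σ A λ a → Σ A λ b →
    R a x × R b x × ¬ S a b × (∀ c → R c x → S c a ⊎ S c b)

record ModelOfTP0 (M : Str) : Set where
  field
    equiv  : ∀ n → IsEquiv (E M n)
    refine : ∀ n {x y} → E M (suc n) x y → E M n x y
    two₀   : ExactlyTwoClasses (E M 0)
    split  : ∀ n (x : Carrier M) → SplitsInTwo (E M n) (E M (suc n)) x

data Ord : Set₁ where
  ozero : Ord
  osuc  : Ord → Ord
  olim  : {I : Set} → (I → Ord) → Ord

Countable : Set → Set
Countable I = Σ (I → ℕ) Injective′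
  where
  Injective′ : (I → ℕ) → Set
  Injective′ f = ∀ {x y} → f x ≡ f y → x ≡ y

data IsCountableOrd : Ord → Set₁ where
  czero : IsCountableOrd ozero
  csuc  : ∀ {α} → IsCountableOrd α → IsCountableOrd (osuc α)
  clim  : ∀ {I} {f : I → Ord} → Countable I →
          (∀ i → IsCountableOrd (f i)) → IsCountableOrd (olim f)

module _ (M N : Str) where

  QfEq : ∀ {n} → Vec (Carrier M) n → Vec (Carrier N) n → Set
  QfEq {n} as bs = ∀ (i j : Fin n) →
      ((lookup as i ≡ lookup as j) ⇔ (lookup bs i ≡ lookup bs j))
    × (∀ k → E M k (lookup as i) (lookup as j) ⇔ E N k (lookup bs i) (lookup bs j))

  BF : Ord → ∀ {n} → Vec (Carrier M) n → Vec (Carrier N) n → Set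
  BF ozero    as bs = QfEq as bs
  BF (osuc α) as bs =
      (∀ a → Σ (Carrier N) λ b → BF α (as ∷ʳ a) (bs ∷ʳ b))
    × (∀ b → Σ (Carrier M) λ a → BF α (as ∷ʳ a) (bs ∷ʳ b))
  -- limits by intersection (the conjunct QfEq only matters for the
  -- degenerate empty supremum, which then correctly denotes 0)
  BF (olim f) as bs = QfEq as bs × (∀ i → BF (f i) as bs)

  BF∞ : ∀ {n} → Vec (Carrier M) n → Vec (Carrier N) n → Set₁
  BF∞ as bs = ∀ α → BF α as bs

ScottRankLE : Str → Ord → Set₁
ScottRankLE M α = ∀ n (as bs : Vec (Carrier M) n) → BF M M α as bs → BF∞ M M as bs

-- sr(M) is countable (< ω₁): the least such α is countable, i.e.
-- some countable α satisfies ScottRankLE.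
HasCountableScottRank : Str → Set₁
HasCountableScottRank M = Σ Ord λ α → IsCountableOrd α × ScottRankLE M α

{-# OPTIONS --safe #-}
module Submission where

-- A model of T_{P_0} is a binary tree whose nodes are the E_n-classes, each point lying on a branch.
-- Relative to a tuple, a new point either is an entry, or lies in the E_∞-class of an entry, or
-- leaves the branch of the entry it follows longest into a sibling cone that contains no entry.
-- Hence tuples of the same quantifier-free type are ≡_∞ once corresponding E_∞-classes have the
-- same number of spare points (tested against every finite bound) and corresponding empty sibling
-- cones are γ-equivalent, provided γ-equivalence of cones already implies (γ+1)-equivalence: these
-- conditions form a back-and-forth system, and ≡_γ implies them when γ ≥ ω. There are only countably
-- many pairs of cones, so γ can be the supremum of ω and of one countable ordinal separating each
-- pair that some countable ordinal separates; cones that are γ- but not (γ+1)-equivalent would then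
-- be separated below γ.

open import Defs
open import Axiom.ExcludedMiddle using (ExcludedMiddle)
open import Axiom.DoubleNegationElimination using (em⇒dne)
open import Level using (0ℓ)
open import Data.Nat using (ℕ; zero; suc; _≤_; s≤s; _≤′_; ≤′-refl; ≤′-step)
open import Data.Nat.Properties using (≤⇒≤′; _≤?_; ≰⇒>; ≤-refl; ≤-trans; ≤-total; 1+n≰n; <-cmp)
open import Data.Bool using (Bool; true; false; if_then_else_)
open import Data.Fin using (Fin; zero; suc; fromℕ; inject₁; lift; punchIn)
open import Data.Fin.Properties using (punchIn-injective; punchInᵢ≢i; 0≢1+n)
open import Data.Vec.Functional using () renaming (_∷_ to _∷ᶠ_)
open import Data.Vec using (Vec; []; _∷_; lookup; _∷ʳ_)
open import Data.Vec.Properties using (insertAt-punchIn)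
open import Data.Product using (∃; ∃-syntax; _×_; _,_; proj₁; proj₂)
import Data.Product as Product
open import Data.Unit using (⊤; tt)
open import Data.Sum using (_⊎_; inj₁; inj₂)
import Data.Sum as Sum
open import Data.Empty using (⊥-elim)
open import Relation.Nullary using (¬_; Dec; yes; no)
open import Relation.Binary.Definitions using (tri<; tri≈; tri>)
open import Relation.Unary using (Pred; U; _⊆_; _≐_)
open import Relation.Binary.PropositionalEquality using (_≡_; _≢_; refl; sym; trans; cong)
open import Function.Definitions using (Injective)
open import Function.Bundles using (_⇔_; mk⇔; Equivalence)
import Function.Properties.Equivalence as ⇔

argmax : ∀ {n} (f : Fin (suc n) → ℕ) → ∃[ j ] ∀ i → f i ≤ f j
argmax {zero}  f = zero , λ { zero → ≤-refl }
argmax {suc n} f = larger (≤-total (f zero) (f (suc j)))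
  where
  j   = proj₁ (argmax λ i → f (suc i))
  max = proj₂ (argmax λ i → f (suc i))
  larger : f zero ≤ f (suc j) ⊎ f (suc j) ≤ f zero → ∃[ j′ ] ∀ i → f i ≤ f j′
  larger (inj₁ f0≤fj) = suc j , λ { zero → f0≤fj ; (suc i) → max i }
  larger (inj₂ fj≤f0) = zero  , λ { zero → ≤-refl ; (suc i) → ≤-trans (max i) fj≤f0 }

-- Countable ordinals

finite : ℕ → Ord
finite zero    = ozero
finite (suc m) = osuc (finite m)

ω : Ord
ω = olim finite

⨆ᵛ : ∀ L → (Vec Bool L → Ord) → Ord
⨆ᵛ zero    f = f []
⨆ᵛ (suc L) f = olim λ b → ⨆ᵛ L λ s → f (b ∷ s)

ℕ-countable : Countable ℕ
ℕ-countable = (λ n → n) , λ e → e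

Bool-countable : Countable Bool
Bool-countable = (λ b → if b then 1 else 0) , injective
  where
  injective : ∀ {b c} → (if b then 1 else 0) ≡ (if c then 1 else 0) → b ≡ c
  injective {true}  {true}  _ = refl
  injective {false} {false} _ = refl

finite-countable : ∀ m → IsCountableOrd (finite m)
finite-countable zero    = czero
finite-countable (suc m) = csuc (finite-countable m)

ω-countable : IsCountableOrd ω
ω-countable = clim ℕ-countable finite-countable

⨆ᵛ-countable : ∀ L (f : Vec Bool L → Ord) → (∀ s → IsCountableOrd (f s)) → IsCountableOrd (⨆ᵛ L f)
⨆ᵛ-countable zero    f c = c []
⨆ᵛ-countable (suc L) f c = clim Bool-countable λ b → ⨆ᵛ-countable L _ λ s → c (b ∷ s)

-- Back-and-forth games with restricted moves

module RestrictedGame (M : Str) where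

  private
    C = Carrier M
    variable
      m n : ℕ
      P Q P′ Q′ : Pred C 0ℓ
      xs ys xs′ ys′ : Vec C n

  -- a record, unlike QfEq, so that the two tuples can be inferred
  infix 4 _≡qf_
  record _≡qf_ (xs ys : Vec C n) : Set where
    constructor qf
    field atomic : QfEq M M xs ys
  open _≡qf_ public

  ≡qf-refl : xs ≡qf xs
  ≡qf-refl = qf λ i j → ⇔.refl , λ k → ⇔.refl

  ≡qf-sym : xs ≡qf ys → ys ≡qf xs
  ≡qf-sym (qf q) = qf λ i j → ⇔.sym (proj₁ (q i j)) , λ k → ⇔.sym (proj₂ (q i j) k)

  Reindexed : (Fin m → Fin n) → Vec C n → Vec C m → Set
  Reindexed f xs xs′ = ∀ i → lookup xs′ i ≡ lookup xs (f i)

  Reindexed-∷ : ∀ (f : Fin m → Fin n) a → Reindexed f xs xs′ → Reindexed (lift 1 f) (a ∷ xs) (a ∷ xs′)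
  Reindexed-∷ f a ex zero    = refl
  Reindexed-∷ f a ex (suc i) = ex i

  ≡qf-reindex : ∀ (f : Fin m → Fin n) → Reindexed f xs xs′ → Reindexed f ys ys′ →
                xs ≡qf ys → xs′ ≡qf ys′
  ≡qf-reindex {xs′ = xs′} {ys′ = ys′} f ex ey (qf q) = qf reindexed
    where
    reindexed : QfEq M M xs′ ys′
    reindexed i j rewrite ex i | ex j | ey i | ey j = q (f i) (f j)

  -- (M, xs) ≡_α (M, ys) with the players' moves restricted to P and Q; unlike BF every stage
  -- records the quantifier-free type, as P or Q may be empty
  BF↾ : Pred C 0ℓ → Pred C 0ℓ → Ord → Vec C n → Vec C n → Set
  BF↾ P Q ozero    xs ys = xs ≡qf ys
  BF↾ P Q (osuc α) xs ys = xs ≡qf ys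
    × (∀ a → P a → ∃[ b ] Q b × BF↾ P Q α (a ∷ xs) (b ∷ ys))
    × (∀ b → Q b → ∃[ a ] P a × BF↾ P Q α (a ∷ xs) (b ∷ ys))
  BF↾ P Q (olim f) xs ys = xs ≡qf ys × (∀ i → BF↾ P Q (f i) xs ys)

  infix 4 _≃[_]_
  _≃[_]_ : Pred C 0ℓ → Ord → Pred C 0ℓ → Set
  P ≃[ α ] Q = BF↾ P Q α [] []

  BF↾-⨆ᵛ : ∀ L (f : Vec Bool L → Ord) s → BF↾ P Q (⨆ᵛ L f) xs ys → BF↾ P Q (f s) xs ys
  BF↾-⨆ᵛ zero    f []      g       = g
  BF↾-⨆ᵛ (suc L) f (b ∷ s) (_ , g) = BF↾-⨆ᵛ L _ s (g b)

  BF↾-qf : ∀ α → BF↾ P Q α xs ys → xs ≡qf ys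
  BF↾-qf ozero    q       = q
  BF↾-qf (osuc α) (q , _) = q
  BF↾-qf (olim f) (q , _) = q

  BF↾-sym : ∀ α → BF↾ P Q α xs ys → BF↾ Q P α ys xs
  BF↾-sym ozero q = ≡qf-sym q
  BF↾-sym (osuc α) (q , forth , back) = ≡qf-sym q ,
    (λ b qb → let a , pa , g = back b qb in a , pa , BF↾-sym α g) ,
    (λ a pa → let b , qb , g = forth a pa in b , qb , BF↾-sym α g)
  BF↾-sym (olim f) (q , g) = ≡qf-sym q , λ i → BF↾-sym (f i) (g i)

  BF↾-reindex : ∀ α (f : Fin m → Fin n) → Reindexed f xs xs′ → Reindexed f ys ys′ →
                BF↾ P Q α xs ys → BF↾ P Q α xs′ ys′
  BF↾-reindex ozero f ex ey q = ≡qf-reindex f ex ey q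
  BF↾-reindex (osuc α) f ex ey (q , forth , back) = ≡qf-reindex f ex ey q ,
    (λ a pa → let b , qb , g = forth a pa in
      b , qb , BF↾-reindex α (lift 1 f) (Reindexed-∷ f a ex) (Reindexed-∷ f b ey) g) ,
    (λ b qb → let a , pa , g = back b qb in
      a , pa , BF↾-reindex α (lift 1 f) (Reindexed-∷ f a ex) (Reindexed-∷ f b ey) g)
  BF↾-reindex (olim h) f ex ey (q , g) = ≡qf-reindex f ex ey q , λ i → BF↾-reindex (h i) f ex ey (g i)

  BF↾-forget : ∀ α → BF↾ P Q α xs ys → P ≃[ α ] Q
  BF↾-forget α = BF↾-reindex α (λ ()) (λ ()) (λ ())

  BF↾-resp-≐ : ∀ α → P ≐ P′ → Q ≐ Q′ → BF↾ P Q α xs ys → BF↾ P′ Q′ α xs ys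
  BF↾-resp-≐ ozero P≐ Q≐ q = q
  BF↾-resp-≐ (osuc α) P≐@(P⊆ , P⊇) Q≐@(Q⊆ , Q⊇) (q , forth , back) = q ,
    (λ a pa → let b , qb , g = forth a (P⊇ pa) in b , Q⊆ qb , BF↾-resp-≐ α P≐ Q≐ g) ,
    (λ b qb → let a , pa , g = back b (Q⊇ qb) in a , P⊆ pa , BF↾-resp-≐ α P≐ Q≐ g)
  BF↾-resp-≐ (olim f) P≐ Q≐ (q , g) = q , λ i → BF↾-resp-≐ (f i) P≐ Q≐ (g i)

  -- D x is defined from x without quantifiers, so a response to a move in D (xs i) lies in D (ys i)
  module _ (D : C → Pred C 0ℓ)
           (D-qf : ∀ {n} {xs ys : Vec C n} → xs ≡qf ys → ∀ i j →
                   D (lookup xs i) (lookup xs j) → D (lookup ys i) (lookup ys j)) where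

    BF↾-restrict : ∀ α (i : Fin n) → D (lookup xs i) ⊆ P → D (lookup ys i) ⊆ Q →
                   BF↾ P Q α xs ys → BF↾ (D (lookup xs i)) (D (lookup ys i)) α xs ys
    BF↾-restrict ozero i D⊆P D⊆Q q = q
    BF↾-restrict (osuc α) i D⊆P D⊆Q (q , forth , back) = q ,
      (λ a da → let b , _ , g = forth a (D⊆P da) in
        b , D-qf (BF↾-qf α g) (suc i) zero da , BF↾-restrict α (suc i) D⊆P D⊆Q g) ,
      (λ b db → let a , _ , g = back b (D⊆Q db) in
        a , D-qf (≡qf-sym (BF↾-qf α g)) (suc i) zero db , BF↾-restrict α (suc i) D⊆P D⊆Q g)
    BF↾-restrict (olim f) i D⊆P D⊆Q (q , g) = q , λ j → BF↾-restrict (f j) i D⊆P D⊆Q (g j)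

  BF-refl : ∀ α (xs : Vec C n) → BF M M α xs xs
  BF-refl ozero    xs = atomic (≡qf-refl {xs = xs})
  BF-refl (osuc α) xs = (λ a → a , BF-refl α _) , (λ a → a , BF-refl α _)
  BF-refl (olim f) xs = atomic (≡qf-refl {xs = xs}) , λ i → BF-refl (f i) xs

  cons-to-snoc : Fin (suc n) → Fin (suc n)
  cons-to-snoc zero    = fromℕ _
  cons-to-snoc (suc i) = inject₁ i

  snoc-to-cons : Fin (suc n) → Fin (suc n)
  snoc-to-cons {zero}  zero    = zero
  snoc-to-cons {suc n} zero    = suc zero
  snoc-to-cons {suc n} (suc i) = punchIn (suc zero) (snoc-to-cons i)

  lookup-∷ʳ-inject₁ : ∀ (xs : Vec C n) a i → lookup (xs ∷ʳ a) (inject₁ i) ≡ lookup xs i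
  lookup-∷ʳ-inject₁ (x ∷ xs) a zero    = refl
  lookup-∷ʳ-inject₁ (x ∷ xs) a (suc i) = lookup-∷ʳ-inject₁ xs a i

  ∷-as-∷ʳ : ∀ (xs : Vec C n) a → Reindexed cons-to-snoc (xs ∷ʳ a) (a ∷ xs)
  ∷-as-∷ʳ xs a zero    = sym (last xs)
    where
    last : ∀ {n} (xs : Vec C n) → lookup (xs ∷ʳ a) (fromℕ n) ≡ a
    last []       = refl
    last (x ∷ xs) = last xs
  ∷-as-∷ʳ xs a (suc i) = sym (lookup-∷ʳ-inject₁ xs a i)

  ∷ʳ-as-∷ : ∀ (xs : Vec C n) a → Reindexed snoc-to-cons (a ∷ xs) (xs ∷ʳ a)
  ∷ʳ-as-∷ []       a zero    = refl
  ∷ʳ-as-∷ (x ∷ xs) a zero    = refl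
  ∷ʳ-as-∷ (x ∷ xs) a (suc i) =
    trans (∷ʳ-as-∷ xs a i) (sym (insertAt-punchIn (a ∷ xs) (suc zero) x (snoc-to-cons i)))

  BF↾-∷ʳ⇒∷ : ∀ α {a b} → BF↾ P Q α (xs ∷ʳ a) (ys ∷ʳ b) → BF↾ P Q α (a ∷ xs) (b ∷ ys)
  BF↾-∷ʳ⇒∷ α {a} {b} = BF↾-reindex α cons-to-snoc (∷-as-∷ʳ _ a) (∷-as-∷ʳ _ b)

  BF↾-∷⇒∷ʳ : ∀ α {a b} → BF↾ P Q α (a ∷ xs) (b ∷ ys) → BF↾ P Q α (xs ∷ʳ a) (ys ∷ʳ b)
  BF↾-∷⇒∷ʳ α {a} {b} = BF↾-reindex α snoc-to-cons (∷ʳ-as-∷ _ a) (∷ʳ-as-∷ _ b)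

  BF↾⇒BF : ∀ α → BF↾ U U α xs ys → BF M M α xs ys
  BF↾⇒BF ozero    q                  = atomic q
  BF↾⇒BF (osuc α) (_ , forth , back) =
    (λ a → let b , _ , g = forth a tt in b , BF↾⇒BF α (BF↾-∷⇒∷ʳ α g)) ,
    (λ b → let a , _ , g = back b tt in a , BF↾⇒BF α (BF↾-∷⇒∷ʳ α g))
  BF↾⇒BF (olim f) (q , g)            = atomic q , λ i → BF↾⇒BF (f i) (g i)

  -- the point c is needed to read off xs ≡qf ys from a successor stage, which BF does not record
  BF⇒BF↾ : C → ∀ α → BF M M α xs ys → BF↾ U U α xs ys
  BF⇒BF↾ c ozero    q              = qf q
  BF⇒BF↾ {xs = xs} {ys} c (osuc α) (forth , back) = qf-prefix ,
    (λ a _ → let b , g = forth a in b , tt , BF↾-∷ʳ⇒∷ α (BF⇒BF↾ c α g)) ,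
    (λ b _ → let a , g = back b in a , tt , BF↾-∷ʳ⇒∷ α (BF⇒BF↾ c α g))
    where
    qf-prefix : xs ≡qf ys
    qf-prefix = let d , g = forth c in
      ≡qf-reindex inject₁ (λ i → sym (lookup-∷ʳ-inject₁ xs c i)) (λ i → sym (lookup-∷ʳ-inject₁ ys d i))
                  (BF↾-qf α (BF⇒BF↾ c α g))
  BF⇒BF↾ c (olim f) (q , g)        = qf q , λ i → BF⇒BF↾ c (f i) (g i)

module _ (lem : ∀ {ℓ} → ExcludedMiddle ℓ) (M : Str) (T : ModelOfTP0 M) where

  open RestrictedGame M
  open ModelOfTP0 T
  open IsEquiv

  private
    C = Carrier M
    variable
      k l m n : ℕ
      a b c x y z w : C
      xs ys : Vec C n

  -- x and y lie in the same node of depth k of the tree: Agree (suc k) is E_k, the root has depth 0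
  Agree : ℕ → C → C → Set
  Agree zero    _ _ = ⊤
  Agree (suc k) x y = E M k x y

  Agree-refl : ∀ k x → Agree k x x
  Agree-refl zero    x = tt
  Agree-refl (suc k) x = refl′ (equiv k) x

  Agree-sym : ∀ k → Agree k x y → Agree k y x
  Agree-sym zero    _ = tt
  Agree-sym (suc k) e = sym′ (equiv k) e

  Agree-trans : ∀ k → Agree k x y → Agree k y z → Agree k x z
  Agree-trans zero    _ _ = tt
  Agree-trans (suc k) e f = trans′ (equiv k) e f

  Agree-pred : ∀ k → Agree (suc k) x y → Agree k x y
  Agree-pred zero    _ = tt
  Agree-pred (suc k) e = refine k e

  Agree-weaken : k ≤ l → Agree l x y → Agree k x y
  Agree-weaken k≤l = weaken′ (≤⇒≤′ k≤l)
    where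
    weaken′ : k ≤′ l → Agree l x y → Agree k x y
    weaken′ ≤′-refl        e = e
    weaken′ (≤′-step k≤′l) e = weaken′ k≤′l (Agree-pred _ e)

  record Split (k : ℕ) (x : C) : Set where
    field
      left right  : C
      left-agree  : Agree k x left
      right-agree : Agree k x right
      apart       : ¬ Agree (suc k) left right
      cover       : ∀ c → Agree k x c → Agree (suc k) left c ⊎ Agree (suc k) right c

  split-at : ∀ k x → Split k x
  split-at zero x = let a , b , a≁b , cover = two₀ in record
    { left = a ; right = b ; left-agree = tt ; right-agree = tt ; apart = a≁b
    ; cover = λ c _ → Sum.map (sym′ (equiv 0)) (sym′ (equiv 0)) (cover c) }
  split-at (suc k) x = let a , b , ax , bx , a≁b , cover = split k x in record
    { left = a ; right = b ; left-agree = sym′ (equiv k) ax ; right-agree = sym′ (equiv k) bx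
    ; apart = a≁b
    ; cover = λ c xc → Sum.map (sym′ (equiv (suc k))) (sym′ (equiv (suc k))) (cover c (sym′ (equiv k) xc)) }

  -- the points leaving the branch of x at depth l: the sibling of x's node of depth l + 1
  Diverge : ℕ → C → Pred C 0ℓ
  Diverge l x a = Agree l x a × ¬ Agree (suc l) x a

  Diverge-sym : Diverge l x a → Diverge l a x
  Diverge-sym {l} (xa , x≁a) = Agree-sym l xa , λ ax → x≁a (Agree-sym (suc l) ax)

  Diverge-respʳ : Agree (suc l) a b → Diverge l x a → Diverge l x b
  Diverge-respʳ {l} ab (xa , x≁a) =
    Agree-trans l xa (Agree-pred l ab) , λ xb → x≁a (Agree-trans (suc l) xb (Agree-sym (suc l) ab))

  Diverge-respˡ : Agree (suc l) x y → Diverge l x a → Diverge l y a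
  Diverge-respˡ xy d = Diverge-sym (Diverge-respʳ xy (Diverge-sym d))

  Diverge-resp-Agree : Agree (suc l) a b → Diverge l a ≐ Diverge l b
  Diverge-resp-Agree {l} ab = Diverge-respˡ ab , Diverge-respˡ (Agree-sym (suc l) ab)

  Diverge-agree : Diverge l x a → Diverge l x b → Agree (suc l) a b
  Diverge-agree {l} {x} {a} {b} (xa , x≁a) (xb , x≁b) =
    same-half (cover a xa) (cover b xb) (cover x (Agree-refl l x))
    where
    open Split (split-at l x)
    _∼_ = Agree (suc l)
    via : ∀ {c d e} → c ∼ d → c ∼ e → d ∼ e
    via cd ce = Agree-trans (suc l) (Agree-sym (suc l) cd) ce
    same-half : left ∼ a ⊎ right ∼ a → left ∼ b ⊎ right ∼ b → left ∼ x ⊎ right ∼ x → a ∼ b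
    same-half (inj₁ la) (inj₁ lb) _         = via la lb
    same-half (inj₂ ra) (inj₂ rb) _         = via ra rb
    same-half (inj₁ la) (inj₂ _)  (inj₁ lx) = ⊥-elim (x≁a (via lx la))
    same-half (inj₁ _)  (inj₂ rb) (inj₂ rx) = ⊥-elim (x≁b (via rx rb))
    same-half (inj₂ _)  (inj₁ lb) (inj₁ lx) = ⊥-elim (x≁b (via lx lb))
    same-half (inj₂ ra) (inj₁ _)  (inj₂ rx) = ⊥-elim (x≁a (via rx ra))

  Diverge-nonempty : ∀ l x → ∃ (Diverge l x)
  Diverge-nonempty l x = other-half (cover x (Agree-refl l x))
    where
    open Split (split-at l x)
    other-half : Agree (suc l) left x ⊎ Agree (suc l) right x → ∃ (Diverge l x)
    other-half (inj₁ lx) = right , right-agree , λ xr → apart (Agree-trans (suc l) lx xr)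
    other-half (inj₂ rx) = left , left-agree ,
      λ xl → apart (Agree-sym (suc l) (Agree-trans (suc l) rx xl))

  node : ∀ L → Vec Bool L → C
  node zero    []      = proj₁ two₀
  node (suc L) (b ∷ s) = if b then left else right
    where open Split (split-at L (node L s))

  Cone : ∀ L → Vec Bool L → Pred C 0ℓ
  Cone L s = Agree L (node L s)

  Cone-cover : ∀ L a → ∃[ s ] Cone L s a
  Cone-cover zero    a = [] , tt
  Cone-cover (suc L) a = half (cover a sa)
    where
    s  = proj₁ (Cone-cover L a)
    sa = proj₂ (Cone-cover L a)
    open Split (split-at L (node L s))
    half : Agree (suc L) left a ⊎ Agree (suc L) right a → ∃[ s′ ] Cone (suc L) s′ a
    half (inj₁ la) = true ∷ s , la
    half (inj₂ ra) = false ∷ s , ra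

  Diverge-cone : ∀ l x → ∃[ s ] Diverge l x ≐ Cone (suc l) s
  Diverge-cone l x = s , (λ xa → Agree-trans (suc l) st (Diverge-agree xt xa))
                       , (λ sa → Diverge-respʳ (Agree-trans (suc l) (Agree-sym (suc l) st) sa) xt)
    where
    t  = proj₁ (Diverge-nonempty l x)
    xt = proj₂ (Diverge-nonempty l x)
    s  = proj₁ (Cone-cover (suc l) t)
    st = proj₂ (Cone-cover (suc l) t)

  Agree-across : Diverge l x z → ¬ Diverge l x y → Agree k z y ⇔ (k ≤ l × Agree k x y)
  Agree-across {l} {x} {z} {y} {k} xz@(xz′ , _) x⋔̸y = mk⇔ to from
    where
    to : Agree k z y → k ≤ l × Agree k x y
    to zy with k ≤? l
    ... | yes k≤l = k≤l , Agree-trans k (Agree-weaken k≤l xz′) zy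
    ... | no  k≰l = ⊥-elim (x⋔̸y (Diverge-respʳ (Agree-weaken (≰⇒> k≰l) zy) xz))
    from : k ≤ l × Agree k x y → Agree k z y
    from (k≤l , xy) = Agree-trans k (Agree-sym k (Agree-weaken k≤l xz′)) xy

  Agree-qf : xs ≡qf ys → ∀ k i j → Agree k (lookup xs i) (lookup xs j) → Agree k (lookup ys i) (lookup ys j)
  Agree-qf q zero    i j _ = tt
  Agree-qf q (suc k) i j e = Equivalence.to (proj₂ (atomic q i j) k) e

  Diverge-qf : xs ≡qf ys → ∀ i j →
               Diverge l (lookup xs i) (lookup xs j) → Diverge l (lookup ys i) (lookup ys j)
  Diverge-qf {l = l} q i j (e , x≁) = Agree-qf q l i j e , λ e′ → x≁ (Agree-qf (≡qf-sym q) (suc l) i j e′)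

  infix 4 _≈∞_
  _≈∞_ : C → C → Set
  x ≈∞ y = ∀ k → Agree k x y

  ≈∞-sym : x ≈∞ y → y ≈∞ x
  ≈∞-sym e k = Agree-sym k (e k)

  ≈∞-trans : x ≈∞ y → y ≈∞ z → x ≈∞ z
  ≈∞-trans e f k = Agree-trans k (e k) (f k)

  ≈∞-qf : xs ≡qf ys → ∀ i j → lookup xs i ≈∞ lookup xs j → lookup ys i ≈∞ lookup ys j
  ≈∞-qf q i j e k = Agree-qf q k i j (e k)

  Agree-resp-≈∞ : a ≈∞ b → Agree k a c ⇔ Agree k b c
  Agree-resp-≈∞ {k = k} a≈b = mk⇔ (Agree-trans k (≈∞-sym a≈b k)) (Agree-trans k (a≈b k))

  ¬≈∞-across : Diverge l x z → ¬ Diverge l x y → ¬ y ≈∞ z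
  ¬≈∞-across {l} xz x⋔̸y y≈z =
    1+n≰n (proj₁ (Equivalence.to (Agree-across xz x⋔̸y) (≈∞-sym y≈z (suc l))))

  Avoids : Pred C 0ℓ → Vec C n → Set
  Avoids P xs = ∀ i → ¬ P (lookup xs i)

  Fresh : C → Vec C n → Set
  Fresh a = Avoids (a ≡_)

  Fresh-qf : (z ∷ xs) ≡qf (w ∷ ys) → Fresh z xs → Fresh w ys
  Fresh-qf q fz j e = fz j (Equivalence.from (proj₁ (atomic q zero (suc j))) e)

  ≡qf-∷ : xs ≡qf ys → (∀ j → (z ≡ lookup xs j) ⇔ (w ≡ lookup ys j)) →
          (∀ j k → E M k z (lookup xs j) ⇔ E M k w (lookup ys j)) → (z ∷ xs) ≡qf (w ∷ ys)
  ≡qf-∷ {z = z} {w = w} q ≡⇔ E⇔ = qf atomic′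
    where
    open Equivalence
    atomic′ : QfEq M M (z ∷ _) (w ∷ _)
    atomic′ zero    zero    = mk⇔ (λ _ → refl) (λ _ → refl) ,
                              λ k → mk⇔ (λ _ → refl′ (equiv k) w) (λ _ → refl′ (equiv k) z)
    atomic′ zero    (suc j) = ≡⇔ j , E⇔ j
    atomic′ (suc i) zero    =
      mk⇔ (λ e → sym (to (≡⇔ i) (sym e))) (λ e → sym (from (≡⇔ i) (sym e))) ,
      λ k → let s = sym′ (equiv k) in mk⇔ (λ e → s (to (E⇔ i k) (s e))) (λ e → s (from (E⇔ i k) (s e)))
    atomic′ (suc i) (suc j) = atomic q i j

  -- Spare points of E_∞-classes

  record Spare (xs : Vec C n) (x : C) (m : ℕ) : Set where
    field
      point     : Fin m → C
      injective : Injective _≡_ _≡_ point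
      in-class  : ∀ p → point p ≈∞ x
      fresh     : ∀ p → Fresh (point p) xs
  open Spare

  Spare-mono : (∀ {a} → a ≈∞ x → Fresh a xs → Fresh a ys) → Spare xs x m → Spare ys x m
  Spare-mono f sp = record
    { point = point sp ; injective = injective sp ; in-class = in-class sp
    ; fresh = λ p → f (in-class sp p) (fresh sp p) }

  Spare-resp-≈∞ : x ≈∞ y → Spare xs x m ⇔ Spare xs y m
  Spare-resp-≈∞ x≈y = mk⇔ (move x≈y) (move (≈∞-sym x≈y))
    where
    move : x ≈∞ y → Spare xs x m → Spare xs y m
    move x≈y sp = record
      { point = point sp ; injective = injective sp ; fresh = fresh sp
      ; in-class = λ p → ≈∞-trans (in-class sp p) x≈y }

  Spare-extend : z ≈∞ x → Fresh z xs → Spare (z ∷ xs) x m → Spare xs x (suc m)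
  Spare-extend {z = z} z≈x fz sp = record
    { point     = z ∷ᶠ point sp
    ; injective = injective′
    ; in-class  = λ { zero → z≈x ; (suc p) → in-class sp p }
    ; fresh     = λ { zero → fz ; (suc p) j → fresh sp p (suc j) }
    }
    where
    injective′ : Injective _≡_ _≡_ (z ∷ᶠ point sp)
    injective′ {zero}  {zero}  _ = refl
    injective′ {zero}  {suc q} e = ⊥-elim (fresh sp q zero (sym e))
    injective′ {suc p} {zero}  e = ⊥-elim (fresh sp p zero e)
    injective′ {suc p} {suc q} e = cong suc (injective sp e)

  Spare-drop : (sp : Spare xs x (suc m)) (p₀ : Fin (suc m)) →
               (∀ q → point sp (punchIn p₀ q) ≢ z) → Spare (z ∷ xs) x m
  Spare-drop sp p₀ avoid = record
    { point     = λ q → point sp (punchIn p₀ q)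
    ; injective = λ e → punchIn-injective p₀ _ _ (injective sp e)
    ; in-class  = λ q → in-class sp (punchIn p₀ q)
    ; fresh     = λ { q zero → avoid q ; q (suc j) → fresh sp _ j }
    }

  Spare-tail : (sp : Spare xs x (suc m)) → Spare (point sp zero ∷ xs) x m
  Spare-tail sp = Spare-drop sp zero λ q e → 0≢1+n (sym (injective sp e))

  Spare-shrink : Spare xs x (suc m) → Spare (z ∷ xs) x m
  Spare-shrink {z = z} sp with lem {P = ∃[ p ] point sp p ≡ z}
  ... | yes (p₀ , p₀↦z) =
    Spare-drop sp p₀ λ q e → punchInᵢ≢i p₀ q (injective sp (trans e (sym p₀↦z)))
  ... | no  z∉sp        = Spare-drop sp zero λ q e → z∉sp (_ , e)

  Spare-∷-fresh : z ≈∞ x → Fresh z xs → Spare (z ∷ xs) x m ⇔ Spare xs x (suc m)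
  Spare-∷-fresh z≈x fz = mk⇔ (Spare-extend z≈x fz) Spare-shrink

  Spare-∷-stale : (z ≈∞ x → ¬ Fresh z xs) → Spare (z ∷ xs) x m ⇔ Spare xs x m
  Spare-∷-stale {z = z} {x = x} {xs = xs} stale =
    mk⇔ (Spare-mono λ _ fa j → fa (suc j)) (Spare-mono fresh-∷)
    where
    fresh-∷ : ∀ {a} → a ≈∞ x → Fresh a xs → Fresh a (z ∷ xs)
    fresh-∷ a≈x fa zero    refl = stale a≈x fa
    fresh-∷ a≈x fa (suc j)      = fa j

  Spare-isolated : Avoids (_≈∞ z) xs → Spare (z ∷ xs) z m ⇔ Spare (z ∷ []) z m
  Spare-isolated {z = z} {xs = xs} iso = mk⇔ (Spare-mono λ _ fa → λ { zero → fa zero }) (Spare-mono fresh-∷)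
    where
    fresh-∷ : ∀ {a} → a ≈∞ z → Fresh a (z ∷ []) → Fresh a (z ∷ xs)
    fresh-∷ a≈z fa zero    = fa zero
    fresh-∷ a≈z fa (suc i) refl = iso i a≈z

  Spare-transfer : ∀ {P Q} m (i : Fin n) → BF↾ P Q (finite m) xs ys → (_≈∞ lookup xs i) ⊆ P →
                   Spare xs (lookup xs i) m → Spare ys (lookup ys i) m
  Spare-transfer zero    i _ _ _ = record { point = λ () ; injective = λ {} ; in-class = λ () ; fresh = λ () }
  Spare-transfer (suc m) i (_ , forth , _) class⊆P sp =
    Spare-extend (≈∞-qf q zero (suc i) (in-class sp zero)) (Fresh-qf q (fresh sp zero)) rest
    where
    response = forth (point sp zero) (class⊆P (in-class sp zero))
    g = proj₂ (proj₂ response)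
    q = BF↾-qf (finite m) g
    rest = Spare-transfer m (suc i) g class⊆P (Spare-tail sp)

  SameSpare : Vec C n → Vec C n → Set
  SameSpare xs ys = ∀ i m → Spare xs (lookup xs i) m ⇔ Spare ys (lookup ys i) m

  SameSpare-∷-old : (z ∷ xs) ≡qf (w ∷ ys) → SameSpare xs ys → ∀ j m →
                    Spare (z ∷ xs) (lookup xs j) m ⇔ Spare (w ∷ ys) (lookup ys j) m
  SameSpare-∷-old {z = z} {xs = xs} q same j m with lem {P = z ≈∞ lookup xs j × Fresh z xs}
  ... | yes (z≈ , fz) =
    ⇔.trans (Spare-∷-fresh z≈ fz)
     (⇔.trans (same j (suc m)) (⇔.sym (Spare-∷-fresh (≈∞-qf q zero (suc j) z≈) (Fresh-qf q fz))))
  ... | no  stale =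
    ⇔.trans (Spare-∷-stale λ z≈ fz → stale (z≈ , fz))
     (⇔.trans (same j m) (⇔.sym (Spare-∷-stale λ w≈ fw →
       stale (≈∞-qf (≡qf-sym q) zero (suc j) w≈ , Fresh-qf (≡qf-sym q) fw))))

  SameSpare-∷ : (z ∷ xs) ≡qf (w ∷ ys) → SameSpare xs ys →
                (∀ m → Spare (z ∷ xs) z m ⇔ Spare (w ∷ ys) w m) → SameSpare (z ∷ xs) (w ∷ ys)
  SameSpare-∷ q same new zero    m = new m
  SameSpare-∷ q same new (suc j) m = SameSpare-∷-old q same j m

  SameSpare-∷-class : (z ∷ xs) ≡qf (w ∷ ys) → SameSpare xs ys → ∀ j → z ≈∞ lookup xs j →
                      SameSpare (z ∷ xs) (w ∷ ys)
  SameSpare-∷-class q same j z≈ = SameSpare-∷ q same λ m →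
    ⇔.trans (Spare-resp-≈∞ z≈)
     (⇔.trans (SameSpare-∷-old q same j m) (⇔.sym (Spare-resp-≈∞ (≈∞-qf q zero (suc j) z≈))))

  -- A back-and-forth system

  SameRegions : Ord → Vec C n → Vec C n → Set
  SameRegions γ xs ys = ∀ l j → Avoids (Diverge l (lookup xs j)) xs →
                        Diverge l (lookup xs j) ≃[ γ ] Diverge l (lookup ys j)

  SameRegions-∷ : ∀ {γ} → SameRegions γ xs ys →
                  (∀ l → Avoids (Diverge l z) (z ∷ xs) → Diverge l z ≃[ γ ] Diverge l w) →
                  SameRegions γ (z ∷ xs) (w ∷ ys)
  SameRegions-∷ same new l zero    av = new l av
  SameRegions-∷ same new l (suc j) av = same l j λ i → av (suc i)

  record Similar (γ : Ord) (xs ys : Vec C n) : Set where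
    field
      qf-type : xs ≡qf ys
      spare   : SameSpare xs ys
      regions : SameRegions γ xs ys
  open Similar

  Similar-sym : ∀ {γ} → Similar γ xs ys → Similar γ ys xs
  Similar-sym {γ = γ} sim = record
    { qf-type = ≡qf-sym (qf-type sim)
    ; spare   = λ i m → ⇔.sym (spare sim i m)
    ; regions = λ l j av → BF↾-sym γ (regions sim l j λ i d → av i (Diverge-qf (qf-type sim) j i d))
    }

  first-failure : (P : ℕ → Set) → P 0 → ∀ k → ¬ P k → ∃[ l ] P l × ¬ P (suc l)
  first-failure P p₀ zero    ¬p = ⊥-elim (¬p p₀)
  first-failure P p₀ (suc k) ¬p with lem {P = P k}
  ... | yes pk  = k , pk , ¬p
  ... | no  ¬pk = first-failure P p₀ k ¬pk

  divergence : ¬ x ≈∞ y → ∃[ l ] Diverge l x y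
  divergence {x = x} {y = y} x≉y with lem {P = ∃[ k ] ¬ Agree k x y}
  ... | yes (k , x≁y) = first-failure (λ k → Agree k x y) tt k x≁y
  ... | no  ∄         = ⊥-elim (x≉y λ k → em⇒dne lem λ x≁y → ∄ (k , x≁y))

  data Position (xs : Vec C n) (z : C) : Set where
    occurs    : ∀ j → z ≡ lookup xs j → Position xs z
    classmate : ∀ j → z ≈∞ lookup xs j → Fresh z xs → Position xs z
    remote    : ∀ l j → Diverge l (lookup xs j) z → Avoids (Diverge l (lookup xs j)) xs → Position xs z

  -- take the entry whose branch z follows longest
  remote-position : (xs : Vec C (suc n)) → (∀ j → ¬ z ≈∞ lookup xs j) →
                    ∃[ l ] ∃[ j ] Diverge l (lookup xs j) z × Avoids (Diverge l (lookup xs j)) xs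
  remote-position {z = z} xs z≉ = depth j₀ , j₀ , diverge j₀ , avoids
    where
    depth : Fin _ → ℕ
    depth j = proj₁ (divergence λ x≈z → z≉ j (≈∞-sym x≈z))
    diverge : ∀ j → Diverge (depth j) (lookup xs j) z
    diverge j = proj₂ (divergence λ x≈z → z≉ j (≈∞-sym x≈z))
    j₀      = proj₁ (argmax depth)
    deepest = proj₂ (argmax depth)
    avoids : Avoids (Diverge (depth j₀) (lookup xs j₀)) xs
    avoids i d = proj₂ (diverge i)
      (Agree-sym (suc (depth i)) (Agree-weaken (s≤s (deepest i)) (Diverge-agree (diverge j₀) d)))

  position : (xs : Vec C (suc n)) (z : C) → Position xs z
  position xs z with lem {P = ∃[ j ] z ≡ lookup xs j}
  ... | yes (j , z≡) = occurs j z≡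
  ... | no  z∉ with lem {P = ∃[ j ] z ≈∞ lookup xs j}
  ...   | yes (j , z≈) = classmate j z≈ λ j z≡ → z∉ (j , z≡)
  ...   | no  z≉       = let l , j , d , av = remote-position xs λ j z≈ → z≉ (j , z≈) in remote l j d av

  remote-≡qf : ∀ {j} → xs ≡qf ys →
               Diverge l (lookup xs j) z → Avoids (Diverge l (lookup xs j)) xs →
               Diverge l (lookup ys j) w → Avoids (Diverge l (lookup ys j)) ys → (z ∷ xs) ≡qf (w ∷ ys)
  remote-≡qf {l = l} {j = j} q xz avx yw avy = ≡qf-∷ q
    (λ i → mk⇔ (λ { refl → ⊥-elim (avx i xz) }) (λ { refl → ⊥-elim (avy i yw) }))
    (λ i k → ⇔.trans (Agree-across xz (avx i))
              (⇔.trans (mk⇔ (Product.map₂ (Agree-qf q (suc k) j i))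
                            (Product.map₂ (Agree-qf (≡qf-sym q) (suc k) j i)))
                (⇔.sym (Agree-across yw (avy i)))))

  module BackAndForth
    (γ : Ord)
    (γ-infinite : ∀ m {P Q n} {xs ys : Vec C n} → BF↾ P Q γ xs ys → BF↾ P Q (finite m) xs ys)
    (γ-stable : ∀ l x y → Diverge l x ≃[ γ ] Diverge l y → Diverge l x ≃[ osuc γ ] Diverge l y)
    where

    extend-classmate : Similar γ xs ys → (z ∷ xs) ≡qf (w ∷ ys) → ∀ j → z ≈∞ lookup xs j →
                       Similar γ (z ∷ xs) (w ∷ ys)
    extend-classmate {xs = xs} {z = z} {w = w} sim q j z≈ = record
      { qf-type = q
      ; spare   = SameSpare-∷-class q (spare sim) j z≈
      ; regions = SameRegions-∷ (regions sim) new
      }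
      where
      w≈ = ≈∞-qf q zero (suc j) z≈
      new : ∀ l → Avoids (Diverge l z) (z ∷ xs) → Diverge l z ≃[ γ ] Diverge l w
      new l av =
        BF↾-resp-≐ γ (Diverge-resp-Agree (≈∞-sym z≈ (suc l))) (Diverge-resp-Agree (≈∞-sym w≈ (suc l)))
        (regions sim l j λ i d → av (suc i) (proj₂ (Diverge-resp-Agree (z≈ (suc l))) d))

    forth-occurs : ∀ j → Similar γ xs ys → Similar γ (lookup xs j ∷ xs) (lookup ys j ∷ ys)
    forth-occurs j sim = extend-classmate sim q j λ k → Agree-refl k _
      where
      q = ≡qf-∷ (qf-type sim) (λ i → proj₁ (atomic (qf-type sim) j i))
                              (λ i → proj₂ (atomic (qf-type sim) j i))

    forth-classmate : ∀ j → Similar γ xs ys → z ≈∞ lookup xs j → Fresh z xs →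
                      ∃[ w ] Similar γ (z ∷ xs) (w ∷ ys)
    forth-classmate {z = z} j sim z≈ fz = mate , extend-classmate sim q j z≈
      where
      partner : Spare _ _ 1
      partner = Equivalence.to (spare sim j 1) record
        { point = λ _ → z ; injective = λ { {zero} {zero} _ → refl }
        ; in-class = λ _ → z≈ ; fresh = λ _ → fz }
      mate  = point partner zero
      mate≈ = in-class partner zero
      q = ≡qf-∷ (qf-type sim)
        (λ i → mk⇔ (λ z≡ → ⊥-elim (fz i z≡)) (λ w≡ → ⊥-elim (fresh partner zero i w≡)))
        (λ i k → ⇔.trans (Agree-resp-≈∞ z≈)
                  (⇔.trans (proj₂ (atomic (qf-type sim) j i) k) (⇔.sym (Agree-resp-≈∞ mate≈))))

    -- regions of z above depth l are those of lookup xs j; deeper ones lie inside the region z came from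
    remote-regions : ∀ {l j} → SameRegions γ xs ys →
                     Diverge l (lookup xs j) z → Diverge l (lookup ys j) w →
                     BF↾ (Diverge l (lookup xs j)) (Diverge l (lookup ys j)) γ (z ∷ []) (w ∷ []) →
                     ∀ l′ → Avoids (Diverge l′ z) (z ∷ xs) → Diverge l′ z ≃[ γ ] Diverge l′ w
    remote-regions {l = l} {j} same xz yw g l′ av with <-cmp l′ l
    ... | tri< l′<l _ _ =
      BF↾-resp-≐ γ (Diverge-resp-Agree (closer xz)) (Diverge-resp-Agree (closer yw))
        (same l′ j λ i d → av (suc i) (proj₁ (Diverge-resp-Agree (closer xz)) d))
      where
      closer : Diverge l x a → Agree (suc l′) x a
      closer xa = Agree-weaken l′<l (proj₁ xa)
    ... | tri≈ _ refl _ = ⊥-elim (av (suc j) (Diverge-sym xz))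
    ... | tri> _ _ l<l′ =
      BF↾-forget γ (BF↾-restrict (Diverge l′) Diverge-qf γ zero (inside xz) (inside yw) g)
      where
      inside : Diverge l x a → Diverge l′ a ⊆ Diverge l x
      inside xa ab = Diverge-respʳ (Agree-weaken l<l′ (proj₁ ab)) xa

    forth-remote : ∀ l j → Similar γ xs ys →
                   Diverge l (lookup xs j) z → Avoids (Diverge l (lookup xs j)) xs →
                   ∃[ w ] Similar γ (z ∷ xs) (w ∷ ys)
    forth-remote {xs = xs} {ys = ys} {z = z} l j sim xz avx = mate , record
      { qf-type = q
      ; spare   = SameSpare-∷ q (spare sim) new-spare
      ; regions = SameRegions-∷ (regions sim) (remote-regions {ys = ys} (regions sim) xz ymate g)
      }
      where
      avy : Avoids (Diverge l (lookup ys j)) ys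
      avy i d = avx i (Diverge-qf (≡qf-sym (qf-type sim)) j i d)
      response = proj₁ (proj₂ (γ-stable l _ _ (regions sim l j avx))) z xz
      mate  = proj₁ response
      ymate = proj₁ (proj₂ response)
      g     = proj₂ (proj₂ response)
      q = remote-≡qf (qf-type sim) xz avx ymate avy
      class⊆ : Diverge l x a → (_≈∞ a) ⊆ Diverge l x
      class⊆ xa c≈a = Diverge-respʳ (≈∞-sym c≈a (suc l)) xa
      new-spare : ∀ m → Spare (z ∷ xs) z m ⇔ Spare (mate ∷ ys) mate m
      new-spare m =
        ⇔.trans (Spare-isolated λ i → ¬≈∞-across xz (avx i))
         (⇔.trans (mk⇔ (Spare-transfer m zero (γ-infinite m g) (class⊆ xz))
                       (Spare-transfer m zero (γ-infinite m (BF↾-sym γ g)) (class⊆ ymate)))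
           (⇔.sym (Spare-isolated λ i → ¬≈∞-across ymate (avy i))))

    forth : {xs ys : Vec C (suc n)} → Similar γ xs ys → ∀ z → ∃[ w ] Similar γ (z ∷ xs) (w ∷ ys)
    forth {xs = xs} {ys} sim z with position xs z
    ... | occurs j refl        = lookup ys j , forth-occurs j sim
    ... | classmate j z≈ fz    = forth-classmate j sim z≈ fz
    ... | remote l j xz avx    = forth-remote l j sim xz avx

    Similar⇒BF↾ : ∀ β {xs ys : Vec C (suc n)} → Similar γ xs ys → BF↾ U U β xs ys
    Similar⇒BF↾ ozero    sim = qf-type sim
    Similar⇒BF↾ (osuc β) sim = qf-type sim ,
      (λ a _ → let b , sim′ = forth sim a in b , tt , Similar⇒BF↾ β sim′) ,
      (λ b _ → let a , sim′ = forth (Similar-sym sim) b in a , tt , Similar⇒BF↾ β (Similar-sym sim′))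
    Similar⇒BF↾ (olim f) sim = qf-type sim , λ i → Similar⇒BF↾ (f i) sim

    BF↾⇒Similar : BF↾ U U γ xs ys → Similar γ xs ys
    BF↾⇒Similar g = record
      { qf-type = BF↾-qf γ g
      ; spare   = λ i m → mk⇔ (Spare-transfer m i (γ-infinite m g) λ _ → tt)
                              (Spare-transfer m i (γ-infinite m (BF↾-sym γ g)) λ _ → tt)
      ; regions = λ l j _ →
          BF↾-forget γ (BF↾-restrict (Diverge l) Diverge-qf γ j (λ _ → tt) (λ _ → tt) g)
      }

  -- The bound on the Scott rank

  Separable : Pred C 0ℓ → Pred C 0ℓ → Set₁
  Separable P Q = ∃[ β ] IsCountableOrd β × ¬ P ≃[ β ] Q

  separator : (P Q : Pred C 0ℓ) → Dec (Separable P Q) → Ord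
  separator P Q (yes (β , _)) = β
  separator P Q (no _)        = ozero

  separator-countable : ∀ P Q d → IsCountableOrd (separator P Q d)
  separator-countable P Q (yes (_ , c , _)) = c
  separator-countable P Q (no _)            = czero

  separator-separates : ∀ P Q d → Separable P Q → ¬ P ≃[ separator P Q d ] Q
  separator-separates P Q (yes (_ , _ , ¬eq)) _   = ¬eq
  separator-separates P Q (no ¬sep)           sep = ⊥-elim (¬sep sep)

  rank-bound : Ord
  rank-bound = olim λ b → if b then ω else olim λ L →
    ⨆ᵛ L λ s → ⨆ᵛ L λ s′ → separator (Cone L s) (Cone L s′) lem

  rank-bound-countable : IsCountableOrd rank-bound
  rank-bound-countable = clim Bool-countable λ where
    true  → ω-countable
    false → clim ℕ-countable λ L → ⨆ᵛ-countable L _ λ s → ⨆ᵛ-countable L _ λ s′ →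
              separator-countable (Cone L s) (Cone L s′) lem

  rank-bound-infinite : ∀ m {P Q n} {xs ys : Vec C n} →
                        BF↾ P Q rank-bound xs ys → BF↾ P Q (finite m) xs ys
  rank-bound-infinite m (_ , g) = proj₂ (g true) m

  -- otherwise osuc rank-bound would be a countable separator of the two cones, yet rank-bound
  -- lies above the separator chosen for them
  rank-bound-stable-cones : ∀ L s s′ → Cone L s ≃[ rank-bound ] Cone L s′ →
                            Cone L s ≃[ osuc rank-bound ] Cone L s′
  rank-bound-stable-cones L s s′ (_ , g) with lem {P = Cone L s ≃[ osuc rank-bound ] Cone L s′}
  ... | yes g′ = g′
  ... | no ¬g′ = ⊥-elim (separator-separates _ _ lem (osuc rank-bound , csuc rank-bound-countable , ¬g′)
                   (BF↾-⨆ᵛ L _ s′ (BF↾-⨆ᵛ L _ s (proj₂ (g false) L))))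

  rank-bound-stable : ∀ l x y → Diverge l x ≃[ rank-bound ] Diverge l y →
                      Diverge l x ≃[ osuc rank-bound ] Diverge l y
  rank-bound-stable l x y g =
    BF↾-resp-≐ (osuc rank-bound) (Product.swap x≐) (Product.swap y≐)
      (rank-bound-stable-cones (suc l) (proj₁ (Diverge-cone l x)) (proj₁ (Diverge-cone l y))
        (BF↾-resp-≐ rank-bound x≐ y≐ g))
    where
    x≐ = proj₂ (Diverge-cone l x)
    y≐ = proj₂ (Diverge-cone l y)

  open BackAndForth rank-bound rank-bound-infinite rank-bound-stable

  scott-rank≤rank-bound : ScottRankLE M rank-bound
  scott-rank≤rank-bound zero    [] [] _  β = BF-refl β []
  scott-rank≤rank-bound (suc n) xs ys bf β =
    BF↾⇒BF β (Similar⇒BF↾ β (BF↾⇒Similar (BF⇒BF↾ (proj₁ two₀) rank-bound bf)))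

  countable-scott-rank : HasCountableScottRank M
  countable-scott-rank = rank-bound , rank-bound-countable , scott-rank≤rank-bound

mainTheorem9 : (lem : ∀ {ℓ} → ExcludedMiddle ℓ) →
    (M : Str) → ModelOfTP0 M → HasCountableScottRank M
mainTheorem9 = countable-scott-rank
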